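{- Let $G$ be an undirected connected loopless multigraph on vertex set $\{0,\dots,n\}$, $n\ge1$, with Laplacian lattice $L_G$. Then the length of the shortest vector of $L_G$ under the simplicial distance function satisfies $\nu_\triangle(L_G)=\mathrm{MC}_\infty(G)$.
   Context: $L_G\subset H_0=\{x\in\mathbb{R}^{n+1}:\sum_ix_i=0\}$ is the set of integer combinations of the rows of the Laplacian $Q(G)=D(G)-A(G)$ (degree matrix minus adjacency matrix with multiplicities). Let $\triangle\subset H_0$ be the convex hull of $t_0,\dots,t_n$, where $t_i$ has $i$-th coordinate $n$ and all others $-1$, and $d_\triangle(p,q)=\inf\{\lambda\ge0:q\in p+\lambda\triangle\}$; for $p,q\in H_0$, $d_\triangle(p,q)=|\min_i(q_i-p_i)|$. Define $\nu_\triangle(L)=\min\{d_\triangle(O,q): q\in L, q\ne O\}$. For a nonempty proper subset $S\subset V(G)$ let $\mu_\infty(S)=\max\{\deg_{S,\bar S}(v):v\in\bar S\}$, where $\deg_{S,\bar S}(v)$ is the number of edges (with multiplicity) joining $v$ to the other side of the cut; $\mathrm{MC}_\infty(G)$ is the minimum of $\mu_\infty(S)$ over all nonempty proper $S$. -}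

module Defs where

open import Data.Nat using (ℕ; zero; suc; _<_; _≤_; _⊔_) renaming (_+_ to _+ℕ_)
open import Data.Integer using (ℤ; +_; -_; _+_; _*_; _⊓_; ∣_∣)
open import Data.Fin using (Fin; zero; suc)
open import Data.Fin.Subset using (Subset; _∈_; _∉_; Nonempty; ∁)
open import Data.Bool using (Bool; true; false; if_then_else_)
open import Data.Vec using (lookup)
open import Data.Product using (Σ; _×_; ∃)
open import Relation.Binary.PropositionalEquality using (_≡_)
open import Relation.Nullary using (¬_; does)
open import Data.Fin using (_≟_)

Multigraph : ℕ → Set
Multigraph n = Fin (suc n) → Fin (suc n) → ℕ

Symmetric : ∀ {n} → Multigraph n → Set
Symmetric A = ∀ i j → A i j ≡ A j i

Loopless : ∀ {n} → Multigraph n → Set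
Loopless A = ∀ i → A i i ≡ 0

data Reach {n} (A : Multigraph n) : Fin (suc n) → Fin (suc n) → Set where
  here : ∀ {i} → Reach A i i
  step : ∀ {i k j} → 0 < A i k → Reach A k j → Reach A i j

Connected : ∀ {n} → Multigraph n → Set
Connected A = ∀ i j → Reach A i j

sumℕ : ∀ {m} → (Fin m → ℕ) → ℕ
sumℕ {zero} f = 0
sumℕ {suc m} f = f zero +ℕ sumℕ (λ i → f (suc i))

sumℤ : ∀ {m} → (Fin m → ℤ) → ℤ
sumℤ {zero} f = + 0
sumℤ {suc m} f = f zero + sumℤ (λ i → f (suc i))

maxℕ : ∀ {m} → (Fin m → ℕ) → ℕ
maxℕ {zero} f = 0
maxℕ {suc m} f = f zero ⊔ maxℕ (λ i → f (suc i))

minℤ : ∀ {m} → (Fin (suc m) → ℤ) → ℤ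
minℤ {zero} f = f zero
minℤ {suc m} f = f zero ⊓ minℤ (λ i → f (suc i))

deg : ∀ {n} → Multigraph n → Fin (suc n) → ℕ
deg A i = sumℕ (A i)

Laplacian : ∀ {n} → Multigraph n → Fin (suc n) → Fin (suc n) → ℤ
Laplacian A i j = if does (i ≟ j) then + deg A i else - (+ A i j)

Point : ℕ → Set
Point n = Fin (suc n) → ℤ

InLattice : ∀ {n} → Multigraph n → Point n → Set
InLattice {n} A q = Σ (Fin (suc n) → ℤ) λ c →
  ∀ j → q j ≡ sumℤ (λ i → c i * Laplacian A i j)

NonZero : ∀ {n} → Point n → Set
NonZero q = ¬ (∀ j → q j ≡ + 0)

-- simplicial distance d_△(O,q) = |min_i q_i| (for q ∈ H_0)
dSimplex : ∀ {n} → Point n → ℕ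
dSimplex q = ∣ minℤ q ∣

IsNu : ∀ {n} → Multigraph n → ℕ → Set
IsNu A m =
  (∃ λ q → InLattice A q × NonZero q × dSimplex q ≡ m) ×
  (∀ q → InLattice A q → NonZero q → m ≤ dSimplex q)

degCut : ∀ {n} → Multigraph n → Subset (suc n) → Fin (suc n) → ℕ
degCut A S v = sumℕ (λ u → if lookup S u then A v u else 0)

muInf : ∀ {n} → Multigraph n → Subset (suc n) → ℕ
muInf A S = maxℕ (λ v → if lookup S v then 0 else degCut A S v)

NonemptyProper : ∀ {m} → Subset m → Set
NonemptyProper S = Nonempty S × Nonempty (∁ S)

IsMCInf : ∀ {n} → Multigraph n → ℕ → Set
IsMCInf {n} A m =
  (∃ λ S → NonemptyProper S × muInf A S ≡ m) ×
  (∀ (S : Subset (suc n)) → NonemptyProper S → m ≤ muInf A S)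

-- For q = Σᵢ cᵢ Qᵢ the coordinate q_v equals Σᵢ (c_v − c_i) A(v,i).  Taking c to be the
-- indicator of a nonempty proper S gives a nonzero lattice vector that is nonnegative on S
-- and equals −deg_{S,S̄}(v) at each v ∉ S, so ν ≤ μ∞(S).  Conversely, for a nonzero lattice
-- vector let S be the set of vertices where c exceeds its minimum: S is nonempty (q ≠ 0) and
-- proper, and at each v ∉ S every edge into S contributes at most −1 to q_v, so
-- q_v ≤ −deg_{S,S̄}(v) and μ∞(S) ≤ d(O,q).

module Submission where

open import Defs
open import Data.Bool using (true; false; if_then_else_)
open import Data.Empty using (⊥; ⊥-elim)
open import Data.Fin using (Fin; zero; suc; _≟_)
open import Data.Fin.Properties using (any?; 0≢1+n)
open import Data.Fin.Subset using (Subset; _∈_; Nonempty; ∁; ⁅_⁆)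
open import Data.Fin.Subset.Properties
  using (x∈⁅x⁆; x∈⁅y⁆⇒x≡y; x∉p⇒x∈∁p; x∈∁p⇒x∉p; anySubset?; nonempty?)
open import Data.Integer as ℤ
  using (ℤ; +_; -_; _+_; _-_; _*_; ∣_∣; -[1+_]; 0ℤ; 1ℤ; -1ℤ; +≤+; -≤-)
  renaming (_≤_ to _≤ℤ_; _<_ to _<ℤ_)
import Data.Integer.Properties as ℤ
open import Data.Integer.Tactic.RingSolver using (solve-∀)
open import Data.Nat using (ℕ; zero; suc; _≤_; _<_; z≤n; s≤s)
import Data.Nat.Properties as ℕ
open import Data.Product using (Σ; ∃; ∃₂; _×_; _,_)
open import Data.Sum using (_⊎_; inj₁; inj₂)
open import Data.Vec using (lookup; tabulate)
open import Data.Vec.Properties using (lookup∘tabulate; []=⇒lookup; lookup⇒[]=)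
open import Function using (_∘_)
open import Relation.Binary.PropositionalEquality
open import Relation.Nullary using (Dec; yes; no; does)
open import Relation.Nullary.Decidable using (_×-dec_; dec-true; dec-false)

sumℤ-cong : ∀ {m} {f g : Fin m → ℤ} → (∀ i → f i ≡ g i) → sumℤ f ≡ sumℤ g
sumℤ-cong {zero}  f≗g = refl
sumℤ-cong {suc m} f≗g = cong₂ _+_ (f≗g zero) (sumℤ-cong (f≗g ∘ suc))

sumℤ-zero : ∀ {m} {f : Fin m → ℤ} → (∀ i → f i ≡ 0ℤ) → sumℤ f ≡ 0ℤ
sumℤ-zero {zero}  f≗0 = refl
sumℤ-zero {suc m} f≗0 = cong₂ _+_ (f≗0 zero) (sumℤ-zero (f≗0 ∘ suc))

sumℤ-mono-≤ : ∀ {m} {f g : Fin m → ℤ} → (∀ i → f i ≤ℤ g i) → sumℤ f ≤ℤ sumℤ g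
sumℤ-mono-≤ {zero}  f≤g = ℤ.≤-refl
sumℤ-mono-≤ {suc m} f≤g = ℤ.+-mono-≤ (f≤g zero) (sumℤ-mono-≤ (f≤g ∘ suc))

sumℤ-nonNeg : ∀ {m} {f : Fin m → ℤ} → (∀ i → 0ℤ ≤ℤ f i) → 0ℤ ≤ℤ sumℤ f
sumℤ-nonNeg {zero}  0≤f = ℤ.≤-refl
sumℤ-nonNeg {suc m} 0≤f = ℤ.+-mono-≤ (0≤f zero) (sumℤ-nonNeg (0≤f ∘ suc))

sumℤ-distrib-- : ∀ {m} (f g : Fin m → ℤ) → sumℤ (λ i → f i - g i) ≡ sumℤ f - sumℤ g
sumℤ-distrib-- {zero}  f g = refl
sumℤ-distrib-- {suc m} f g = begin
  f zero - g zero + sumℤ (λ i → f (suc i) - g (suc i))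
    ≡⟨ cong (_+_ (f zero - g zero)) (sumℤ-distrib-- (f ∘ suc) (g ∘ suc)) ⟩
  f zero - g zero + (sumℤ (f ∘ suc) - sumℤ (g ∘ suc))
    ≡⟨ interchange (f zero) (g zero) _ _ ⟩
  f zero + sumℤ (f ∘ suc) - (g zero + sumℤ (g ∘ suc))
    ∎
  where
  open ≡-Reasoning
  interchange : ∀ a b s t → a - b + (s - t) ≡ a + s - (b + t)
  interchange = solve-∀

sumℤ-neg : ∀ {m} (f : Fin m → ℤ) → - sumℤ f ≡ sumℤ (-_ ∘ f)
sumℤ-neg {zero}  f = refl
sumℤ-neg {suc m} f = trans (ℤ.neg-distrib-+ (f zero) _) (cong (_+_ (- f zero)) (sumℤ-neg (f ∘ suc)))

*-distribˡ-sumℤ : ∀ {m} x (f : Fin m → ℤ) → x * sumℤ f ≡ sumℤ (λ i → x * f i)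
*-distribˡ-sumℤ {zero}  x f = ℤ.*-zeroʳ x
*-distribˡ-sumℤ {suc m} x f =
  trans (ℤ.*-distribˡ-+ x (f zero) _) (cong (_+_ (x * f zero)) (*-distribˡ-sumℤ x (f ∘ suc)))

pos-sumℕ : ∀ {m} (f : Fin m → ℕ) → + sumℕ f ≡ sumℤ (+_ ∘ f)
pos-sumℕ {zero}  f = refl
pos-sumℕ {suc m} f = trans (ℤ.pos-+ (f zero) _) (cong (_+_ (+ f zero)) (pos-sumℕ (f ∘ suc)))

sumℤ-select : ∀ {m} (j : Fin m) (x : ℤ) → sumℤ (λ i → if does (i ≟ j) then x else 0ℤ) ≡ x
sumℤ-select {suc m} zero    x =
  trans (cong (_+_ x) (sumℤ-zero {m} {λ _ → 0ℤ} (λ _ → refl))) (ℤ.+-identityʳ x)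
sumℤ-select {suc m} (suc j) x = trans (ℤ.+-identityˡ _) (sumℤ-select j x)

sumℕ-term : ∀ {m} (f : Fin m → ℕ) u → f u ≤ sumℕ f
sumℕ-term f zero    = ℕ.m≤m+n (f zero) _
sumℕ-term f (suc u) = ℕ.≤-trans (sumℕ-term (f ∘ suc) u) (ℕ.m≤n+m _ (f zero))

maxℕ-term : ∀ {m} (f : Fin m → ℕ) u → f u ≤ maxℕ f
maxℕ-term f zero    = ℕ.m≤m⊔n (f zero) _
maxℕ-term f (suc u) = ℕ.≤-trans (maxℕ-term (f ∘ suc) u) (ℕ.m≤n⊔m (f zero) _)

maxℕ-lub : ∀ {m} (f : Fin m → ℕ) {b} → (∀ u → f u ≤ b) → maxℕ f ≤ b
maxℕ-lub {zero}  f f≤b = z≤n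
maxℕ-lub {suc m} f f≤b = ℕ.⊔-lub (f≤b zero) (maxℕ-lub (f ∘ suc) (f≤b ∘ suc))

minℤ-term : ∀ {m} (f : Fin (suc m) → ℤ) u → minℤ f ≤ℤ f u
minℤ-term {zero}  f zero    = ℤ.≤-refl
minℤ-term {suc m} f zero    = ℤ.i⊓j≤i (f zero) _
minℤ-term {suc m} f (suc u) = ℤ.≤-trans (ℤ.i⊓j≤j (f zero) _) (minℤ-term (f ∘ suc) u)

minℤ-glb : ∀ {m} (f : Fin (suc m) → ℤ) {b} → (∀ u → b ≤ℤ f u) → b ≤ℤ minℤ f
minℤ-glb {zero}  f b≤f = b≤f zero
minℤ-glb {suc m} f b≤f = ℤ.⊓-glb (b≤f zero) (minℤ-glb (f ∘ suc) (b≤f ∘ suc))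

minℤ-attained : ∀ {m} (f : Fin (suc m) → ℤ) → ∃ λ j → minℤ f ≡ f j
minℤ-attained {zero}  f = zero , refl
minℤ-attained {suc m} f with ℤ.⊓-sel (f zero) (minℤ (f ∘ suc))
... | inj₁ min≡f₀ = zero , min≡f₀
... | inj₂ min≡rest with minℤ-attained (f ∘ suc)
...   | j , rest≡fj = suc j , trans min≡rest rest≡fj

i<j⇒i-j≤-1 : ∀ {i j} → i <ℤ j → i - j ≤ℤ -1ℤ
i<j⇒i-j≤-1 {i} {j} i<j =
  ℤ.i<j⇒i≤pred[j] (subst (i - j <ℤ_) (ℤ.+-inverseʳ j) (ℤ.+-monoˡ-< (- j) i<j))

i≤-n⇒n≤∣i∣ : ∀ {i n} → i ≤ℤ - + n → n ≤ ∣ i ∣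
i≤-n⇒n≤∣i∣ {n = zero}                 _         = z≤n
i≤-n⇒n≤∣i∣ { -[1+ k ]} {suc n} (-≤- n≤k) = s≤s n≤k

-n≤i≤0⇒∣i∣≤n : ∀ {i n} → - + n ≤ℤ i → i ≤ℤ 0ℤ → ∣ i ∣ ≤ n
-n≤i≤0⇒∣i∣≤n {+ zero}              _         _         = z≤n
-n≤i≤0⇒∣i∣≤n {+ suc k}             _         (+≤+ ())
-n≤i≤0⇒∣i∣≤n { -[1+ k ]} {suc n} (-≤- k≤n) _         = s≤s k≤n

≤-1⇒*≤neg : ∀ {d} a → d ≤ℤ -1ℤ → d * + a ≤ℤ - + a
≤-1⇒*≤neg a d≤-1 = ℤ.≤-trans (ℤ.*-monoʳ-≤-nonNeg (+ a) d≤-1) (ℤ.≤-reflexive (ℤ.-1*i≡-i (+ a)))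

≤0⇒*≤0 : ∀ {d} a → d ≤ℤ 0ℤ → d * + a ≤ℤ 0ℤ
≤0⇒*≤0 a d≤0 = ℤ.*-monoʳ-≤-nonNeg (+ a) d≤0

0<n⇒-n≢0 : ∀ {n} → 0 < n → - + n ≢ 0ℤ
0<n⇒-n≢0 {suc n} _ ()

Least : ∀ {p} → (ℕ → Set p) → ℕ → Set p
Least P m = P m × (∀ k → P k → m ≤ k)

module _ {p} {P : ℕ → Set p} (P? : ∀ k → Dec (P k)) where

  private
    least-below : ∀ k → (∀ j → P j → k ≤ j) ⊎ ∃ (Least P)
    least-below zero = inj₁ (λ _ _ → z≤n)
    least-below (suc k) with least-below k | P? k
    ... | inj₂ least | _      = inj₂ least
    ... | inj₁ k≤P   | yes Pk = inj₂ (k , Pk , k≤P)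
    ... | inj₁ k≤P   | no ¬Pk = inj₁ (λ j Pj → ℕ.≤∧≢⇒< (k≤P j Pj) (λ { refl → ¬Pk Pj }))

  least-witness : ∀ {k} → P k → ∃ (Least P)
  least-witness {k} Pk with least-below (suc k)
  ... | inj₁ k<P   = ⊥-elim (ℕ.<-irrefl refl (k<P k Pk))
  ... | inj₂ least = least

cut : ∀ {m} → Subset m → (Fin m → ℕ) → ℕ
cut T a = sumℕ (λ i → if lookup T i then a i else 0)

neg-cut : ∀ {m} (T : Subset m) (a : Fin m → ℕ) →
  - + cut T a ≡ sumℤ (λ i → - + (if lookup T i then a i else 0))
neg-cut T a = trans (cong -_ (pos-sumℕ a∣T)) (sumℤ-neg (+_ ∘ a∣T))
  where
  a∣T : _ → ℕ
  a∣T i = if lookup T i then a i else 0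

weighted-sum-≤-cut : ∀ {m} (T : Subset m) (d : Fin m → ℤ) (a : Fin m → ℕ) →
  (∀ i → d i ≤ℤ 0ℤ) → (∀ i → lookup T i ≡ true → d i ≤ℤ -1ℤ) →
  sumℤ (λ i → d i * + a i) ≤ℤ - + cut T a
weighted-sum-≤-cut T d a d≤0 d≤-1 =
  ℤ.≤-trans (sumℤ-mono-≤ term) (ℤ.≤-reflexive (sym (neg-cut T a)))
  where
  term : ∀ i → d i * + a i ≤ℤ - + (if lookup T i then a i else 0)
  term i with lookup T i in i∈T
  ... | true  = ≤-1⇒*≤neg (a i) (d≤-1 i i∈T)
  ... | false = ≤0⇒*≤0 (a i) (d≤0 i)

dSimplex-≥ : ∀ {n} {q : Point n} {a} v → q v ≤ℤ - + a → a ≤ dSimplex q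
dSimplex-≥ {q = q} v qv≤-a = i≤-n⇒n≤∣i∣ (ℤ.≤-trans (minℤ-term q v) qv≤-a)

dSimplex-≤ : ∀ {n} {q : Point n} {a} y → (∀ v → - + a ≤ℤ q v) → q y ≤ℤ 0ℤ → dSimplex q ≤ a
dSimplex-≤ {q = q} y -a≤q qy≤0 = -n≤i≤0⇒∣i∣≤n (minℤ-glb q -a≤q) (ℤ.≤-trans (minℤ-term q y) qy≤0)

module _ {n} (A : Multigraph n) (S : Subset (suc n)) where

  degCut≤muInf : ∀ {v} → lookup S v ≡ false → degCut A S v ≤ muInf A S
  degCut≤muInf {v} v∉S = subst (_≤ muInf A S) (cong (if_then 0 else degCut A S v) v∉S)
    (maxℕ-term (λ u → if lookup S u then 0 else degCut A S u) v)

  muInf-lub : ∀ {b} → (∀ v → lookup S v ≡ false → degCut A S v ≤ b) → muInf A S ≤ b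
  muInf-lub bound = maxℕ-lub _ term
    where
    term : ∀ v → (if lookup S v then 0 else degCut A S v) ≤ _
    term v with lookup S v in v∉S
    ... | true  = z≤n
    ... | false = bound v v∉S

lookup≡false⇒∈∁ : ∀ {m} {S : Subset m} {x} → lookup S x ≡ false → x ∈ ∁ S
lookup≡false⇒∈∁ x∉S = x∉p⇒x∈∁p λ x∈S → true≢false (trans (sym ([]=⇒lookup x∈S)) x∉S)
  where
  true≢false : true ≡ false → ⊥
  true≢false ()

∈∁⇒lookup≡false : ∀ {m} {S : Subset m} {x} → x ∈ ∁ S → lookup S x ≡ false
∈∁⇒lookup≡false {S = S} {x} x∈∁S with lookup S x in x∈S
... | false = refl
... | true  = ⊥-elim (x∈∁p⇒x∉p x∈∁S (lookup⇒[]= x S x∈S))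

⁅0⁆-proper : ∀ {n} → NonemptyProper {suc (suc n)} ⁅ zero ⁆
⁅0⁆-proper = (zero , x∈⁅x⁆ zero) , (suc zero , x∉p⇒x∈∁p (0≢1+n ∘ sym ∘ x∈⁅y⁆⇒x≡y zero))

Reach-crosses : ∀ {n} {A : Multigraph n} (T : Subset (suc n)) {x y} → Reach A x y →
  lookup T x ≡ true → lookup T y ≡ false →
  ∃₂ λ i k → lookup T i ≡ true × lookup T k ≡ false × 0 < A i k
Reach-crosses T here x∈T x∉T with trans (sym x∈T) x∉T
... | ()
Reach-crosses T (step {k = k} edge walk) x∈T y∉T with lookup T k in k∈T
... | true  = Reach-crosses T walk k∈T y∉T
... | false = _ , k , x∈T , k∈T , edge

indicator : ∀ {m} → Subset m → Fin m → ℤ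
indicator T i = if lookup T i then 1ℤ else 0ℤ

combination : ∀ {n} → Multigraph n → (Fin (suc n) → ℤ) → Point n
combination A c j = sumℤ (λ i → c i * Laplacian A i j)

module _ {n} {A : Multigraph n} (symmetric : Symmetric A) (loopless : Loopless A) where

  laplacian-entry : ∀ (c : Fin (suc n) → ℤ) i j →
    c i * Laplacian A i j ≡ (if does (i ≟ j) then c j * + deg A j else 0ℤ) - c i * + A j i
  laplacian-entry c i j with i ≟ j
  ... | yes refl rewrite loopless i | ℤ.*-zeroʳ (c i) = sym (ℤ.+-identityʳ _)
  ... | no _ rewrite symmetric j i =
    trans (sym (ℤ.neg-distribʳ-* (c i) (+ A i j))) (sym (ℤ.+-identityˡ _))

  combination-as-flow : ∀ c j → combination A c j ≡ sumℤ (λ i → (c j - c i) * + A j i)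
  combination-as-flow c j = begin
    sumℤ (λ i → c i * Laplacian A i j)
      ≡⟨ sumℤ-cong (λ i → laplacian-entry c i j) ⟩
    sumℤ (λ i → diagonal i - outflow i)
      ≡⟨ sumℤ-distrib-- diagonal outflow ⟩
    sumℤ diagonal - sumℤ outflow
      ≡⟨ cong (_- sumℤ outflow) (sumℤ-select j _) ⟩
    c j * + sumℕ (A j) - sumℤ outflow
      ≡⟨ cong (λ s → c j * s - sumℤ outflow) (pos-sumℕ (A j)) ⟩
    c j * sumℤ (λ i → + A j i) - sumℤ outflow
      ≡⟨ cong (_- sumℤ outflow) (*-distribˡ-sumℤ (c j) (λ i → + A j i)) ⟩
    sumℤ inflow - sumℤ outflow
      ≡⟨ sumℤ-distrib-- inflow outflow ⟨
    sumℤ (λ i → inflow i - outflow i)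
      ≡⟨ sumℤ-cong (λ i → *-distribʳ-- (c j) (c i) (+ A j i)) ⟩
    sumℤ (λ i → (c j - c i) * + A j i)
      ∎
    where
    open ≡-Reasoning
    diagonal outflow inflow : Fin (suc n) → ℤ
    diagonal i = if does (i ≟ j) then c j * + deg A j else 0ℤ
    outflow  i = c i * + A j i
    inflow   i = c j * + A j i
    *-distribʳ-- : ∀ x y a → x * a - y * a ≡ (x - y) * a
    *-distribʳ-- = solve-∀

  combination-const : ∀ {c : Fin (suc n) → ℤ} {x} → (∀ i → c i ≡ x) → ∀ j → combination A c j ≡ 0ℤ
  combination-const {c} {x} c≡x j = trans (combination-as-flow c j) (sumℤ-zero term)
    where
    term : ∀ i → (c j - c i) * + A j i ≡ 0ℤ
    term i rewrite c≡x j | c≡x i | ℤ.+-inverseʳ x = ℤ.*-zeroˡ (+ A j i)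

  combination-≤-cut : ∀ (c : Fin (suc n) → ℤ) (T : Subset (suc n)) v →
    (∀ i → c v ≤ℤ c i) → (∀ i → lookup T i ≡ true → c v <ℤ c i) →
    combination A c v ≤ℤ - + degCut A T v
  combination-≤-cut c T v cv≤ cv< = subst (_≤ℤ _) (sym (combination-as-flow c v))
    (weighted-sum-≤-cut T (λ i → c v - c i) (A v)
      (λ i → ℤ.i≤j⇒i-j≤0 (cv≤ i)) (λ i i∈T → i<j⇒i-j≤-1 (cv< i i∈T)))

  lattice-vector-dominates-cut : ∀ q → InLattice A q → NonZero q →
    ∃ λ T → NonemptyProper T × muInf A T ≤ dSimplex q
  lattice-vector-dominates-cut q (c , q≡) q≢0 =
    T , (T-nonempty , ∁T-nonempty) , muInf-lub A T (λ v v∉T → dSimplex-≥ v (q≤-degCut v v∉T))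
    where
    μ : ℤ
    μ = minℤ c
    T : Subset (suc n)
    T = tabulate (λ i → does (μ ℤ.<? c i))

    lookup-T : ∀ i → lookup T i ≡ does (μ ℤ.<? c i)
    lookup-T = lookup∘tabulate (λ i → does (μ ℤ.<? c i))

    above : ∀ {i} → lookup T i ≡ true → μ <ℤ c i
    above {i} i∈T with μ ℤ.<? c i | trans (sym i∈T) (lookup-T i)
    ... | yes μ<ci | _  = μ<ci
    ... | no _     | ()

    not-above : ∀ {i} → lookup T i ≡ false → c i ≤ℤ μ
    not-above {i} i∉T with μ ℤ.<? c i | trans (sym i∉T) (lookup-T i)
    ... | no μ≮ci | _  = ℤ.≮⇒≥ μ≮ci
    ... | yes _   | ()

    ∁T-nonempty : Nonempty (∁ T)
    ∁T-nonempty with minℤ-attained c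
    ... | j , μ≡cj = j , lookup≡false⇒∈∁
      (trans (lookup-T j) (dec-false (μ ℤ.<? c j) (ℤ.<-irrefl μ≡cj)))

    T-nonempty : Nonempty T
    T-nonempty with any? (λ i → μ ℤ.<? c i)
    ... | yes (i , μ<ci) = i , lookup⇒[]= i T (trans (lookup-T i) (dec-true (μ ℤ.<? c i) μ<ci))
    ... | no ∄ = ⊥-elim (q≢0 (λ j → trans (q≡ j) (combination-const c≡μ j)))
      where
      c≡μ : ∀ i → c i ≡ μ
      c≡μ i = ℤ.≤-antisym (ℤ.≮⇒≥ (λ μ<ci → ∄ (i , μ<ci))) (minℤ-term c i)

    q≤-degCut : ∀ v → lookup T v ≡ false → q v ≤ℤ - + degCut A T v
    q≤-degCut v v∉T = subst (_≤ℤ - + degCut A T v) (sym (q≡ v)) (combination-≤-cut c T v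
      (λ i → ℤ.≤-trans (not-above v∉T) (minℤ-term c i))
      (λ i i∈T → ℤ.≤-<-trans (not-above v∉T) (above i∈T)))

  cut-lattice-vector : Connected A → ∀ T → NonemptyProper T →
    ∃ λ q → InLattice A q × NonZero q × dSimplex q ≤ muInf A T
  cut-lattice-vector connected T ((x , x∈T) , (y , y∈∁T)) =
    q , (indicator T , λ _ → refl) , q≢0 , dSimplex-≤ y q≥-muInf (q-outside-≤0 y∉T)
    where
    q : Point n
    q = combination A (indicator T)

    y∉T : lookup T y ≡ false
    y∉T = ∈∁⇒lookup≡false y∈∁T

    q-outside : ∀ {v} → lookup T v ≡ false → q v ≡ - + degCut A T v
    q-outside {v} v∉T =
      trans (combination-as-flow (indicator T) v) (trans (sumℤ-cong term) (sym (neg-cut T (A v))))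
      where
      term : ∀ i → (indicator T v - indicator T i) * + A v i ≡ - + (if lookup T i then A v i else 0)
      term i with lookup T i
      ... | true  rewrite v∉T = ℤ.-1*i≡-i (+ A v i)
      ... | false rewrite v∉T = refl

    q-inside : ∀ {v} → lookup T v ≡ true → 0ℤ ≤ℤ q v
    q-inside {v} v∈T = subst (0ℤ ≤ℤ_) (sym (combination-as-flow (indicator T) v)) (sumℤ-nonNeg term)
      where
      term : ∀ i → 0ℤ ≤ℤ (indicator T v - indicator T i) * + A v i
      term i with lookup T i
      ... | true  rewrite v∈T = ℤ.≤-refl
      ... | false rewrite v∈T = subst (0ℤ ≤ℤ_) (sym (ℤ.*-identityˡ (+ A v i))) (+≤+ z≤n)

    q-outside-≤0 : ∀ {v} → lookup T v ≡ false → q v ≤ℤ 0ℤ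
    q-outside-≤0 v∉T = subst (_≤ℤ 0ℤ) (sym (q-outside v∉T)) ℤ.neg-≤-pos

    q≥-muInf : ∀ v → - + muInf A T ≤ℤ q v
    q≥-muInf v with lookup T v in T[v]
    ... | true  = ℤ.≤-trans ℤ.neg-≤-pos (q-inside T[v])
    ... | false = ℤ.≤-trans (ℤ.neg-mono-≤ (+≤+ (degCut≤muInf A T T[v])))
                            (ℤ.≤-reflexive (sym (q-outside T[v])))

    q≢0 : NonZero q
    q≢0 q≡0 with Reach-crosses T (connected x y) ([]=⇒lookup x∈T) y∉T
    ... | i , k , i∈T , k∉T , 0<Aik =
      0<n⇒-n≢0 0<degCut (trans (sym (q-outside k∉T)) (q≡0 k))
      where
      0<degCut : 0 < degCut A T k
      0<degCut = ℕ.<-≤-trans (subst (0 <_) (symmetric i k) 0<Aik)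
        (subst (λ b → (if b then A k i else 0) ≤ degCut A T k) i∈T
          (sumℕ-term (λ u → if lookup T u then A k u else 0) i))

MCInf-exists : ∀ {n} → 1 ≤ n → (A : Multigraph n) → ∃ (IsMCInf A)
MCInf-exists {suc n} _ A =
  let m , attained , minimal = least-witness cut-width? (⁅ zero ⁆ , ⁅0⁆-proper , refl)
  in m , attained , λ S S-proper → minimal _ (S , S-proper , refl)
  where
  cut-width? : ∀ k → Dec (∃ λ S → NonemptyProper S × muInf A S ≡ k)
  cut-width? k = anySubset? (λ S → (nonempty? S ×-dec nonempty? (∁ S)) ×-dec (muInf A S ℕ.≟ k))

IsMCInf⇒IsNu : ∀ {n} {A : Multigraph n} {m} → Symmetric A → Loopless A → Connected A →
  IsMCInf A m → IsNu A m
IsMCInf⇒IsNu {A = A} {m} symmetric loopless connected ((S , S-proper , μS≡m) , m≤μ) = shortest , m≤d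
  where
  m≤d : ∀ q → InLattice A q → NonZero q → m ≤ dSimplex q
  m≤d q q∈L q≢0 with lattice-vector-dominates-cut symmetric loopless q q∈L q≢0
  ... | T , T-proper , μT≤d = ℕ.≤-trans (m≤μ T T-proper) μT≤d

  shortest : ∃ λ q → InLattice A q × NonZero q × dSimplex q ≡ m
  shortest with cut-lattice-vector symmetric loopless connected S S-proper
  ... | q , q∈L , q≢0 , d≤μS =
    q , q∈L , q≢0 , ℕ.≤-antisym (subst (dSimplex q ≤_) μS≡m d≤μS) (m≤d q q∈L q≢0)

mainTheorem6 : ∀ (n : ℕ) → 1 ≤ n → (A : Multigraph n) →
    Symmetric A → Loopless A → Connected A →
    Σ ℕ (λ m → IsNu A m × IsMCInf A m)
mainTheorem6 n 1≤n A symmetric loopless connected with MCInf-exists 1≤n A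
... | m , m-is-MC = m , IsMCInf⇒IsNu symmetric loopless connected m-is-MC , m-is-MC
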